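{- Let $p=(123,\emptyset,\emptyset)$ and $r=(231,\emptyset,\{1\})$. Then for every $n\ge 0$, \[\mathrm{Av}_n(p,r)=\mathrm{Av}_n(123,231).\]
   Context: For $n\ge 0$, $\mathcal{S}_n$ is the set of permutations of $[n]=\{1,\dots,n\}$, written as words $\pi=\pi(1)\pi(2)\cdots\pi(n)$. Two words of distinct integers of the same length are order-isomorphic if their entries appear in the same relative order. A pattern of length 3 is a triple $(\sigma,X,Y)$ with $\sigma\in\mathcal{S}_3$ and $X,Y\subseteq\{1,2\}$. A permutation $\pi\in\mathcal{S}_n$ contains $(\sigma,X,Y)$ if there are indices $i_1<i_2<i_3$ such that $\pi(i_1)\pi(i_2)\pi(i_3)$ is order-isomorphic to $\sigma$, $i_{x+1}=i_x+1$ for every $x\in X$, and $j_{y+1}=j_y+1$ for every $y\in Y$, where $j_1<j_2<j_3$ are the three values $\pi(i_1),\pi(i_2),\pi(i_3)$ listed in increasing order; otherwise $\pi$ avoids it. A classical pattern $\sigma$ means $(\sigma,\emptyset,\emptyset)$. For patterns $P_1,\dots,P_m$, $\mathrm{Av}_n(P_1,\dots,P_m)$ is the set of $\pi\in\mathcal{S}_n$ avoiding every $P_i$. -}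

module Defs where

open import Data.Nat.Base using (ℕ; suc)
open import Data.Fin.Base using (Fin; zero; suc; toℕ; inject₁; _<_)
open import Data.Fin.Permutation using (Permutation′; permutation; _⟨$⟩ʳ_; _⟨$⟩ˡ_)
import Data.Fin.Permutation as P
open import Data.Fin.Subset using (Subset; _∈_; ⊥; ⁅_⁆)
open import Data.Product using (Σ; _×_; ∃)
open import Function.Bundles using (_⇔_)
open import Relation.Binary.PropositionalEquality using (_≡_; refl)
open import Relation.Nullary using (¬_)

-- Elements of [k] = {1,…,k} are represented by Fin k (zero ↦ 1, …).
-- A permutation π ∈ S_n is a bijection Fin n ↔ Fin n; the word is
-- π(1)π(2)⋯π(n), i.e. position i ↦ value π ⟨$⟩ʳ i.

record Pattern : Set where
  constructor pat
  field
    σ : Permutation′ 3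
    X : Subset 2
    Y : Subset 2

-- An occurrence of (σ,X,Y) in π: indices i₁<i₂<i₃ (a strictly
-- increasing i : Fin 3 → Fin n) such that
--  * π(i₁)π(i₂)π(i₃) is order-isomorphic to σ,
--  * i_{x+1} = i_x + 1 for x ∈ X,
--  * j_{y+1} = j_y + 1 for y ∈ Y, where j₁<j₂<j₃ are the values
--    π(i₁),π(i₂),π(i₃) in increasing order.  Given order-isomorphism with
--    σ, the k-th smallest value is the one at position σ⁻¹(k), so
--    j_k = π(i_{σ⁻¹(k)}).
Occurrence : ∀ {n} → Permutation′ n → Pattern → (Fin 3 → Fin n) → Set
Occurrence {n} π (pat σ X Y) i =
  (∀ (a b : Fin 3) → a < b → i a < i b)
  × (∀ (a b : Fin 3) → (val a < val b) ⇔ (σ ⟨$⟩ʳ a < σ ⟨$⟩ʳ b))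
  × (∀ (x : Fin 2) → x ∈ X → toℕ (i (suc x)) ≡ suc (toℕ (i (inject₁ x))))
  × (∀ (y : Fin 2) → y ∈ Y → toℕ (j (suc y)) ≡ suc (toℕ (j (inject₁ y))))
  where
  val : Fin 3 → Fin n
  val a = π ⟨$⟩ʳ i a
  j : Fin 3 → Fin n
  j k = val (σ ⟨$⟩ˡ k)

Contains : ∀ {n} → Permutation′ n → Pattern → Set
Contains π P = ∃ λ i → Occurrence π P i

Avoids : ∀ {n} → Permutation′ n → Pattern → Set
Avoids π P = ¬ Contains π P

σ123 : Permutation′ 3
σ123 = P.id

σ231 : Permutation′ 3
σ231 = permutation f g fg gf
  where
  f : Fin 3 → Fin 3
  f zero = suc zero
  f (suc zero) = suc (suc zero)
  f (suc (suc zero)) = zero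
  g : Fin 3 → Fin 3
  g zero = suc (suc zero)
  g (suc zero) = zero
  g (suc (suc zero)) = suc zero
  fg : ∀ x → f (g x) ≡ x
  fg zero = refl
  fg (suc zero) = refl
  fg (suc (suc zero)) = refl
  gf : ∀ x → g (f x) ≡ x
  gf zero = refl
  gf (suc zero) = refl
  gf (suc (suc zero)) = refl

classical : Permutation′ 3 → Pattern
classical σ = pat σ ⊥ ⊥

p : Pattern
p = classical σ123

-- r = (231, ∅, {1})   ({1} is the singleton of the first element of Fin 2)
r : Pattern
r = pat σ231 ⊥ ⁅ zero ⁆

-- A 231-occurrence b c a (positions x < y < z, values π z < π x < π y)
-- whose outer values π z, π x are not adjacent can be shortened: let k be
-- the position of the value π z + 1.  If k lies left of y, then (k, y, z)
-- is an occurrence of r; otherwise (x, y, k) is a 231-occurrence with a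
-- smaller value gap.  Descending on the gap, a permutation avoiding r
-- avoids 231; conversely every occurrence of r is one of 231.
module Submission where

open import Defs
open import Data.Nat.Base as ℕ using (ℕ; zero; suc; _+_; z≤n; s≤s)
import Data.Nat.Properties as ℕ
open import Data.Fin.Base using (Fin; zero; suc; toℕ; fromℕ<; inject₁; _<_)
open import Data.Fin.Properties
  using (toℕ<n; toℕ-fromℕ<; toℕ-injective; <-cmp; <-trans; <-asym; <-irrefl)
open import Data.Fin.Permutation
  using (Permutation′; _⟨$⟩ʳ_; _⟨$⟩ˡ_; inverseʳ)
open import Data.Fin.Subset.Properties using (∉⊥; x∈⁅y⁆⇒x≡y)
open import Data.Product using (_×_; _,_; ∃; proj₁; proj₂)
open import Data.Empty using (⊥-elim) renaming (⊥ to Empty)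
open import Function.Bundles using (_⇔_; mk⇔; Equivalence; Injection)
open import Function.Properties.Inverse using (↔⇒↣)
open import Relation.Binary.PropositionalEquality
  using (_≡_; _≢_; refl; sym; trans; cong; subst)
open import Relation.Binary.Definitions using (Tri; tri<; tri≈; tri>)

occurrence⇒classical : ∀ {n} (π : Permutation′ n) (P : Pattern) {i} →
  Occurrence π P i → Occurrence π (classical (Pattern.σ P)) i
occurrence⇒classical π (pat σ X Y) (increasing , orderIso , _ , _) =
  increasing , orderIso , (λ _ x∈⊥ → ⊥-elim (∉⊥ x∈⊥)) , (λ _ y∈⊥ → ⊥-elim (∉⊥ y∈⊥))

contains⇒contains-classical : ∀ {n} (π : Permutation′ n) (P : Pattern) →
  Contains π P → Contains π (classical (Pattern.σ P))
contains⇒contains-classical π P (i , occ) = i , occurrence⇒classical π P occ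

triple : ∀ {n} → Fin n → Fin n → Fin n → Fin 3 → Fin n
triple x y z zero = x
triple x y z (suc zero) = y
triple x y z (suc (suc zero)) = z

triple-increasing : ∀ {n} {x y z : Fin n} → x < y → y < z →
  ∀ a b → a < b → triple x y z a < triple x y z b
triple-increasing x<y y<z zero (suc zero) _ = x<y
triple-increasing x<y y<z zero (suc (suc zero)) _ = <-trans x<y y<z
triple-increasing x<y y<z (suc zero) (suc (suc zero)) _ = y<z
triple-increasing x<y y<z (suc zero) (suc zero) (s≤s ())
triple-increasing x<y y<z (suc (suc zero)) (suc (suc zero)) (s≤s (s≤s ()))

module _ {n : ℕ} (π : Permutation′ n) where

  record Is231 (x y z : Fin n) : Set where
    field
      x<y : x < y
      y<z : y < z
      πz<πx : π ⟨$⟩ʳ z < π ⟨$⟩ʳ x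
      πx<πy : π ⟨$⟩ʳ x < π ⟨$⟩ʳ y

  module _ {x y z : Fin n} (w : Is231 x y z) where
    open Is231 w

    private
      val : Fin 3 → Fin n
      val a = π ⟨$⟩ʳ triple x y z a

    Is231-orderIso : ∀ a b → (val a < val b) ⇔ (σ231 ⟨$⟩ʳ a < σ231 ⟨$⟩ʳ b)
    Is231-orderIso zero zero = mk⇔ (λ h → ⊥-elim (<-irrefl refl h)) λ { (s≤s ()) }
    Is231-orderIso zero (suc zero) = mk⇔ (λ _ → s≤s (s≤s z≤n)) (λ _ → πx<πy)
    Is231-orderIso zero (suc (suc zero)) = mk⇔ (λ h → ⊥-elim (<-asym h πz<πx)) λ ()
    Is231-orderIso (suc zero) zero = mk⇔ (λ h → ⊥-elim (<-asym h πx<πy)) λ { (s≤s ()) }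
    Is231-orderIso (suc zero) (suc zero) =
      mk⇔ (λ h → ⊥-elim (<-irrefl refl h)) λ { (s≤s (s≤s ())) }
    Is231-orderIso (suc zero) (suc (suc zero)) =
      mk⇔ (λ h → ⊥-elim (<-asym h (<-trans πz<πx πx<πy))) λ ()
    Is231-orderIso (suc (suc zero)) zero = mk⇔ (λ _ → s≤s z≤n) (λ _ → πz<πx)
    Is231-orderIso (suc (suc zero)) (suc zero) =
      mk⇔ (λ _ → s≤s z≤n) (λ _ → <-trans πz<πx πx<πy)
    Is231-orderIso (suc (suc zero)) (suc (suc zero)) =
      mk⇔ (λ h → ⊥-elim (<-irrefl refl h)) λ ()

    -- The adjacency condition of r concerns the smallest value, at z, and the
    -- middle one, at x.
    Is231⇒occurrence-r : toℕ (π ⟨$⟩ʳ x) ≡ suc (toℕ (π ⟨$⟩ʳ z)) →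
      Occurrence π r (triple x y z)
    Is231⇒occurrence-r adjacent =
      triple-increasing x<y y<z , Is231-orderIso , (λ _ x∈⊥ → ⊥-elim (∉⊥ x∈⊥)) ,
      λ j j∈⁅0⁆ → subst (λ c → toℕ (val (σ231 ⟨$⟩ˡ suc c))
                                 ≡ suc (toℕ (val (σ231 ⟨$⟩ˡ inject₁ c))))
                        (sym (x∈⁅y⁆⇒x≡y zero j∈⁅0⁆)) adjacent

  occurrence-231⇒Is231 : ∀ {i} → Occurrence π (classical σ231) i →
    Is231 (i zero) (i (suc zero)) (i (suc (suc zero)))
  occurrence-231⇒Is231 (increasing , orderIso , _ , _) = record
    { x<y = increasing zero (suc zero) (s≤s z≤n)
    ; y<z = increasing (suc zero) (suc (suc zero)) (s≤s (s≤s z≤n))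
    ; πz<πx = Equivalence.from (orderIso (suc (suc zero)) zero) (s≤s z≤n)
    ; πx<πy = Equivalence.from (orderIso zero (suc zero)) (s≤s (s≤s z≤n))
    }

  position-of-successor : ∀ {x z : Fin n} → π ⟨$⟩ʳ z < π ⟨$⟩ʳ x →
    ∃ λ k → toℕ (π ⟨$⟩ʳ k) ≡ suc (toℕ (π ⟨$⟩ʳ z))
  position-of-successor {x} πz<πx =
    π ⟨$⟩ˡ fromℕ< bound , trans (cong toℕ (inverseʳ π)) (toℕ-fromℕ< bound)
    where
    bound : suc (toℕ (π ⟨$⟩ʳ _)) ℕ.< n
    bound = ℕ.≤-<-trans πz<πx (toℕ<n (π ⟨$⟩ʳ x))

  Avoids-r⇒lower-231 : Avoids π r → ∀ {x y z} → Is231 x y z →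
    ∃ λ k → Is231 x y k × toℕ (π ⟨$⟩ʳ k) ≡ suc (toℕ (π ⟨$⟩ʳ z))
  Avoids-r⇒lower-231 avoid {x} {y} {z} w = k , lowered (<-cmp k y) , πk≡πz+1
    where
    open Is231 w
    k : Fin n
    k = proj₁ (position-of-successor πz<πx)
    πk≡πz+1 : toℕ (π ⟨$⟩ʳ k) ≡ suc (toℕ (π ⟨$⟩ʳ z))
    πk≡πz+1 = proj₂ (position-of-successor πz<πx)
    πz<πk : π ⟨$⟩ʳ z < π ⟨$⟩ʳ k
    πz<πk = ℕ.≤-reflexive (sym πk≡πz+1)
    πk≤πx : toℕ (π ⟨$⟩ʳ k) ℕ.≤ toℕ (π ⟨$⟩ʳ x)
    πk≤πx = ℕ.≤-trans (ℕ.≤-reflexive πk≡πz+1) πz<πx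
    lowered : Tri (k < y) (k ≡ y) (y < k) → Is231 x y k
    lowered (tri< k<y _ _) = ⊥-elim (avoid (triple k y z , Is231⇒occurrence-r w′ πk≡πz+1))
      where
      w′ : Is231 k y z
      w′ = record
        { x<y = k<y ; y<z = y<z ; πz<πx = πz<πk ; πx<πy = ℕ.≤-<-trans πk≤πx πx<πy }
    lowered (tri≈ _ k≡y _) =
      ⊥-elim (<-irrefl (cong (π ⟨$⟩ʳ_) k≡y) (ℕ.≤-<-trans πk≤πx πx<πy))
    lowered (tri> _ _ y<k) = record
      { x<y = x<y ; y<z = y<k ; πz<πx = ℕ.≤∧≢⇒< πk≤πx πk≢πx ; πx<πy = πx<πy }
      where
      πk≢πx : toℕ (π ⟨$⟩ʳ k) ≢ toℕ (π ⟨$⟩ʳ x)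
      πk≢πx πk≡πx = <-irrefl refl (subst (x <_) k≡x (<-trans x<y y<k))
        where
        k≡x : k ≡ x
        k≡x = Injection.injective (↔⇒↣ π) (toℕ-injective πk≡πx)

  Avoids-r⇒¬Is231-gap≤ : Avoids π r → ∀ d {x y z} → Is231 x y z →
    toℕ (π ⟨$⟩ʳ x) ℕ.≤ d + toℕ (π ⟨$⟩ʳ z) → Empty
  Avoids-r⇒¬Is231-gap≤ avoid zero w gap≤0 =
    ℕ.<-irrefl refl (ℕ.<-≤-trans (Is231.πz<πx w) gap≤0)
  Avoids-r⇒¬Is231-gap≤ avoid (suc d) {x} {z = z} w gap≤d+1
    with Avoids-r⇒lower-231 avoid w
  ... | k , w′ , πk≡πz+1 = Avoids-r⇒¬Is231-gap≤ avoid d w′ gap≤d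
    where
    gap≤d : toℕ (π ⟨$⟩ʳ x) ℕ.≤ d + toℕ (π ⟨$⟩ʳ k)
    gap≤d = begin
      toℕ (π ⟨$⟩ʳ x)           ≤⟨ gap≤d+1 ⟩
      suc d + toℕ (π ⟨$⟩ʳ z)   ≡⟨ sym (ℕ.+-suc d _) ⟩
      d + suc (toℕ (π ⟨$⟩ʳ z)) ≡⟨ cong (d +_) (sym πk≡πz+1) ⟩
      d + toℕ (π ⟨$⟩ʳ k)       ∎
      where open ℕ.≤-Reasoning

  Avoids-r⇒Avoids-231 : Avoids π r → Avoids π (classical σ231)
  Avoids-r⇒Avoids-231 avoid (i , occ) =
    Avoids-r⇒¬Is231-gap≤ avoid (toℕ (π ⟨$⟩ʳ i zero)) (occurrence-231⇒Is231 occ) (ℕ.m≤m+n _ _)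

proposition8 : (n : ℕ) (π : Permutation′ n) →
    (Avoids π p × Avoids π r) ⇔ (Avoids π (classical σ123) × Avoids π (classical σ231))
proposition8 n π = mk⇔
  (λ (avoid-p , avoid-r) → avoid-p , Avoids-r⇒Avoids-231 π avoid-r)
  (λ (avoid-123 , avoid-231) → avoid-123 , λ c → avoid-231 (contains⇒contains-classical π r c))
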